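{- Let $G$ be a graph of order $n$ with complement $\overline{G}$, such that $\gamma_i(G)\ge 2$ and $\gamma_i(\overline{G})\ge 2$. Then $st_{id}(G)+st_{id}(\overline{G})\le n$ if $n$ is even, and $st_{id}(G)+st_{id}(\overline{G})\le n-1$ if $n$ is odd.
   Context: All graphs are finite and simple. An independent dominating set of a graph $G$ is a set $S\subseteq V(G)$ of pairwise non-adjacent vertices such that every vertex not in $S$ has a neighbour in $S$. The independent domination number $\gamma_i(G)$ is the minimum size of an independent dominating set (for the null graph with no vertices, $\gamma_i=0$). The independent domination stability $st_{id}(G)$ is the minimum number of vertices whose removal from $G$ yields a graph with independent domination number different from $\gamma_i(G)$. -}

module Defs where

open import Data.Bool using (Bool; true; false; not; if_then_else_)
open import Data.Nat using (ℕ; _≤_)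
open import Data.Fin using (Fin; _≟_)
open import Data.Fin.Subset using (Subset; _∈_; _∉_; _⊆_; ∣_∣; ⊤; ∁)
open import Data.Product using (Σ; _×_; ∃)
open import Relation.Nullary using (¬_; does)
open import Relation.Binary.PropositionalEquality using (_≡_)

record Graph (n : ℕ) : Set where
  field
    adj     : Fin n → Fin n → Bool
    sym     : ∀ u v → adj u v ≡ adj v u
    irrefl  : ∀ v → adj v v ≡ false
open Graph public

complement : ∀ {n} → Graph n → Graph n
complement {n} G = record { adj = a ; sym = s ; irrefl = i }
  where
  a : Fin n → Fin n → Bool
  a u v = if does (u ≟ v) then false else not (adj G u v)
  s : ∀ u v → a u v ≡ a v u
  s u v with u ≟ v | v ≟ u
  ... | Relation.Nullary.yes _ | Relation.Nullary.yes _ = _≡_.refl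
  ... | Relation.Nullary.yes p | Relation.Nullary.no q = Data.Empty.⊥-elim (q (Relation.Binary.PropositionalEquality.sym p))
    where import Data.Empty
  ... | Relation.Nullary.no p | Relation.Nullary.yes q = Data.Empty.⊥-elim (p (Relation.Binary.PropositionalEquality.sym q))
    where import Data.Empty
  ... | Relation.Nullary.no _ | Relation.Nullary.no _ =
    Relation.Binary.PropositionalEquality.cong not (sym G u v)
  i : ∀ v → a v v ≡ false
  i v with v ≟ v
  ... | Relation.Nullary.yes _ = _≡_.refl
  ... | Relation.Nullary.no p = Data.Empty.⊥-elim (p _≡_.refl)
    where import Data.Empty

Independent : ∀ {n} → Graph n → Subset n → Set
Independent G S = ∀ u v → u ∈ S → v ∈ S → adj G u v ≡ false

Dominates : ∀ {n} → Graph n → Subset n → Subset n → Set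
Dominates G S W = ∀ v → v ∈ W → v ∉ S → ∃ λ u → u ∈ S × adj G u v ≡ true

-- S is an independent dominating set of the induced subgraph G[W].
IsIDS : ∀ {n} → Graph n → Subset n → Subset n → Set
IsIDS G W S = S ⊆ W × Independent G S × Dominates G S W

IsIDNumberOn : ∀ {n} → Graph n → Subset n → ℕ → Set
IsIDNumberOn G W k =
  (∃ λ S → IsIDS G W S × ∣ S ∣ ≡ k) × (∀ S → IsIDS G W S → k ≤ ∣ S ∣)

IsIDNumber : ∀ {n} → Graph n → ℕ → Set
IsIDNumber G k = IsIDNumberOn G ⊤ k

ChangesIDNumber : ∀ {n} → Graph n → Subset n → Set
ChangesIDNumber G R =
  ∀ k k' → IsIDNumber G k → IsIDNumberOn G (∁ R) k' → ¬ (k ≡ k')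

IsIDStability : ∀ {n} → Graph n → ℕ → Set
IsIDStability G s =
  (∃ λ R → ChangesIDNumber G R × ∣ R ∣ ≡ s) × (∀ R → ChangesIDNumber G R → s ≤ ∣ R ∣)

module Submission where

open import Defs
open import Data.Nat using (ℕ; zero; suc; _+_; _∸_; _≤_; _<_; _%_; s≤s)
open import Data.Nat.Properties using (≤-trans; ≤-pred; +-mono-≤; +-monoʳ-<; m+[n∸m]≡n; n≤1+n)
open import Data.Bool using (true; false; not)
open import Data.Bool.Properties using (not-injective)
open import Data.Fin using (Fin; _≟_) renaming (zero to fzero)
open import Data.Fin.Subset using (Subset; _∈_; _∉_; _⊂_; ∣_∣; ∁; ⁅_⁆)
open import Data.Fin.Subset.Properties
  using (x∈⁅x⁆; x∈⁅y⁆⇒x≡y; ∣⁅x⁆∣≡1; ∣p∣≤n; ∣∁p∣≡n∸∣p∣; x∉p⇒x∈∁p; x∈∁p⇒x∉p; p⊂q⇒∣p∣<∣q∣)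
open import Data.Vec using ([]; lookup; tabulate)
open import Data.Vec.Properties using ([]=⇒lookup; lookup⇒[]=; lookup∘tabulate)
open import Data.Product using (_×_; _,_; proj₁; proj₂)
open import Data.Empty using (⊥-elim)
open import Relation.Nullary using (¬_; yes; no)
open import Relation.Binary.PropositionalEquality
  using (_≡_; _≢_; refl; trans; cong; module ≡-Reasoning)
  renaming (sym to ≡-sym)

-- Removing from a graph H all non-neighbours of a vertex v leaves its closed
-- neighbourhood N[v], in which {v} alone is independent and dominating.  So if
-- γᵢ(H) ≥ 2 this removal changes γᵢ, and st_id(H) ≤ n − 1 − deg_H(v).  The
-- non-neighbours of v in G and in its complement are disjoint and avoid v, so
-- st_id(G) + st_id(Ḡ) ≤ n − 1 whatever the parity of n.  (For n = 0 the
-- hypotheses fail, as γᵢ of the null graph is 0.)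

∣p∣+∣q∣<n : ∀ {n} {p q : Subset n} {x : Fin n} →
            (∀ {y} → y ∈ p → y ∉ q) → x ∉ p → x ∉ q → ∣ p ∣ + ∣ q ∣ < n
∣p∣+∣q∣<n {n} {p} {q} {x} p∩q≡∅ x∉p x∉q = begin-strict
  ∣ p ∣ + ∣ q ∣         <⟨ +-monoʳ-< ∣ p ∣ (p⊂q⇒∣p∣<∣q∣ q⊂∁p) ⟩
  ∣ p ∣ + ∣ ∁ p ∣       ≡⟨ cong (∣ p ∣ +_) (∣∁p∣≡n∸∣p∣ p) ⟩
  ∣ p ∣ + (n ∸ ∣ p ∣)   ≡⟨ m+[n∸m]≡n (∣p∣≤n p) ⟩
  n                     ∎
  where
  open Data.Nat.Properties.≤-Reasoning
  q⊂∁p : q ⊂ ∁ p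
  q⊂∁p = (λ y∈q → x∉p⇒x∈∁p (λ y∈p → p∩q≡∅ y∈p y∈q)) , x , x∉p⇒x∈∁p x∉p , x∉q

neighbourhood : ∀ {n} → Graph n → Fin n → Subset n
neighbourhood H v = tabulate (adj H v)

∈-neighbourhood⁺ : ∀ {n} (H : Graph n) {v w} → adj H v w ≡ true → w ∈ neighbourhood H v
∈-neighbourhood⁺ H {v} {w} vw = lookup⇒[]= w _ (trans (lookup∘tabulate (adj H v) w) vw)

∈-neighbourhood⁻ : ∀ {n} (H : Graph n) {v w} → w ∈ neighbourhood H v → adj H v w ≡ true
∈-neighbourhood⁻ H {v} {w} w∈ = trans (≡-sym (lookup∘tabulate (adj H v) w)) ([]=⇒lookup w∈)

∉-neighbourhood⁺ : ∀ {n} (H : Graph n) {v w} → adj H v w ≡ false → w ∉ neighbourhood H v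
∉-neighbourhood⁺ H vw w∈ with trans (≡-sym vw) (∈-neighbourhood⁻ H w∈)
... | ()

v∉neighbourhood : ∀ {n} (H : Graph n) v → v ∉ neighbourhood H v
v∉neighbourhood H v = ∉-neighbourhood⁺ H (irrefl H v)

adj-complement : ∀ {n} (H : Graph n) {v w} → v ≢ w → adj (complement H) v w ≡ not (adj H v w)
adj-complement H {v} {w} v≢w with v ≟ w
... | yes v≡w = ⊥-elim (v≢w v≡w)
... | no _    = refl

neighbourhood-complement-disjoint : ∀ {n} (H : Graph n) {v w} →
  w ∈ neighbourhood H v → w ∉ neighbourhood (complement H) v
neighbourhood-complement-disjoint H {v} {w} w∈ = ∉-neighbourhood⁺ (complement H) (begin
  adj (complement H) v w  ≡⟨ adj-complement H v≢w ⟩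
  not (adj H v w)         ≡⟨ cong not (∈-neighbourhood⁻ H w∈) ⟩
  false                   ∎)
  where
  open ≡-Reasoning
  v≢w : v ≢ w
  v≢w refl = v∉neighbourhood H v w∈

nonNeighbours : ∀ {n} → Graph n → Fin n → Subset n
nonNeighbours H = neighbourhood (complement H)

⁅v⁆-isIDS-closedNeighbourhood : ∀ {n} (H : Graph n) v → IsIDS H (∁ (nonNeighbours H v)) ⁅ v ⁆
⁅v⁆-isIDS-closedNeighbourhood H v = ⊆-closed , independent , dominates
  where
  ⊆-closed : ∀ {x} → x ∈ ⁅ v ⁆ → x ∈ ∁ (nonNeighbours H v)
  ⊆-closed x∈ with x∈⁅y⁆⇒x≡y v x∈
  ... | refl = x∉p⇒x∈∁p (v∉neighbourhood (complement H) v)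

  independent : Independent H ⁅ v ⁆
  independent u w u∈ w∈ with x∈⁅y⁆⇒x≡y v u∈ | x∈⁅y⁆⇒x≡y v w∈
  ... | refl | refl = irrefl H v

  dominates : Dominates H ⁅ v ⁆ (∁ (nonNeighbours H v))
  dominates w w∈ w∉⁅v⁆ = v , x∈⁅x⁆ v , not-injective not-vw
    where
    v≢w : v ≢ w
    v≢w refl = w∉⁅v⁆ (x∈⁅x⁆ v)
    not-vw : not (adj H v w) ≡ not true
    not-vw with adj (complement H) v w in eq
    ... | false = trans (≡-sym (adj-complement H v≢w)) eq
    ... | true  = ⊥-elim (x∈∁p⇒x∉p w∈ (∈-neighbourhood⁺ (complement H) eq))

removing-nonNeighbours-changesIDNumber : ∀ {n} (H : Graph n) {g} v →
  IsIDNumber H g → 2 ≤ g → ChangesIDNumber H (nonNeighbours H v)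
removing-nonNeighbours-changesIDNumber H v γᵢ≡g 2≤g k k' γᵢ≡k γᵢ-v≡k' refl
  with proj₁ γᵢ≡k
... | S , S-isIDS , ∣S∣≡k = 2≰1 (begin
  2      ≤⟨ 2≤g ⟩
  _      ≤⟨ proj₂ γᵢ≡g S S-isIDS ⟩
  ∣ S ∣  ≡⟨ ∣S∣≡k ⟩
  k      ≤⟨ proj₂ γᵢ-v≡k' ⁅ v ⁆ (⁅v⁆-isIDS-closedNeighbourhood H v) ⟩
  ∣ ⁅ v ⁆ ∣ ≡⟨ ∣⁅x⁆∣≡1 v ⟩
  1      ∎)
  where
  open Data.Nat.Properties.≤-Reasoning
  2≰1 : ¬ (2 ≤ 1)
  2≰1 (s≤s ())

stability≤∣nonNeighbours∣ : ∀ {n} (H : Graph n) {g s} v →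
  IsIDNumber H g → 2 ≤ g → IsIDStability H s → s ≤ ∣ nonNeighbours H v ∣
stability≤∣nonNeighbours∣ H v γᵢ≡g 2≤g st≡s =
  proj₂ st≡s (nonNeighbours H v) (removing-nonNeighbours-changesIDNumber H v γᵢ≡g 2≤g)

mainTheorem12 : (n : ℕ) (G : Graph n) (gi gci si sci : ℕ) →
    IsIDNumber G gi → 2 ≤ gi →
    IsIDNumber (complement G) gci → 2 ≤ gci →
    IsIDStability G si → IsIDStability (complement G) sci →
    (n % 2 ≡ 0 → si + sci ≤ n) × (n % 2 ≡ 1 → si + sci ≤ n ∸ 1)
mainTheorem12 zero _ .0 _ _ _ (([] , _ , refl) , _) () _ _ _ _
mainTheorem12 (suc m) G gi gci si sci γᵢG 2≤gi γᵢḠ 2≤gci stG stḠ =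
  (λ _ → ≤-trans sum≤m (n≤1+n m)) , (λ _ → sum≤m)
  where
  v : Fin (suc m)
  v = fzero
  Ḡ : Graph (suc m)
  Ḡ = complement G
  sum≤m : si + sci ≤ m
  sum≤m = ≤-pred (≤-trans
    (s≤s (+-mono-≤ (stability≤∣nonNeighbours∣ G v γᵢG 2≤gi stG)
                   (stability≤∣nonNeighbours∣ Ḡ v γᵢḠ 2≤gci stḠ)))
    (∣p∣+∣q∣<n (neighbourhood-complement-disjoint Ḡ {v})
               (v∉neighbourhood Ḡ v) (v∉neighbourhood (complement Ḡ) v)))
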